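{- Let $a$ be a weak composition with exactly two nonzero parts and no leading zero (that is, $a_1\neq 0$). Then $\kappa_a$ is multiplicity free.
   Context: A weak composition $a=(a_1,\dots,a_\ell)$ of length $\ell$ is a finite sequence of nonnegative integers. A diagram is a finite set of cells $(r,c)$ with $r,c$ positive integers (row $r$ from the bottom, column $c$ from the left). A Kohnert tableau of content $a$ is a diagram filled with positive integers, exactly $a_i$ cells containing $i$ for each $i$, such that: (i) for each $i$ there is exactly one $i$ in each of the columns $1,\dots,a_i$; (ii) every entry in row $r$ is at least $r$; (iii) for each $i$, the cells containing $i$ weakly descend from left to right; (iv) if $i<j$ appear in the same column with $i$ above $j$, then there is an $i$ in the column immediately to the right of the cell containing that $j$, in a row strictly above it. It is quasi-Yamanouchi if moreover (v) for each nonempty row $r$, either row $r$ contains an entry equal to $r$, or some cell of row $r+1$ lies weakly to the right of some cell of row $r$. Let $\mathrm{QKT}(a)$ be the set of quasi-Yamanouchi Kohnert tableaux of content $a$, and $\mathrm{wt}(T)$ the weak composition of length $\ell$ whose $r$-th part is the number of cells in row $r$ of $T$. The key polynomial $\kappa_a$ satisfies $\kappa_a=\sum_{T\in\mathrm{QKT}(a)}\mathfrak{F}_{\mathrm{wt}(T)}$, where $\mathfrak{F}_b$ is the fundamental slide polynomial. We say $\kappa_a$ is multiplicity free if distinct tableaux in $\mathrm{QKT}(a)$ have distinct weights. -}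

module Defs where

open import Data.Nat using (ℕ; zero; suc; _≤_; _<_; _≟_)
open import Data.Fin using (Fin; toℕ)
open import Data.Vec using (Vec; lookup; toList)
open import Data.List using (List; length; filter; map; allFin)
open import Data.Nat.ListAction using (sum)
open import Data.Product using (Σ; _×_; ∃-syntax)
open import Data.Sum using (_⊎_)
open import Relation.Nullary using (¬_)
open import Relation.Nullary.Decidable using (¬?)
open import Relation.Binary.PropositionalEquality using (_≡_; _≢_)

-- A weak composition of length ℓ is  a : Vec ℕ ℓ ; its i-th part
-- (1-based) is  lookup a i  with  i : Fin ℓ  standing for the label  suc (toℕ i).
-- Columns are 1-based: c : Fin (a_i) stands for column  suc (toℕ c).

label : {ℓ : ℕ} → Fin ℓ → ℕ
label i = suc (toℕ i)

col : {n : ℕ} → Fin n → ℕ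
col c = suc (toℕ c)

-- A filling of content a satisfying condition (i): for every label i and every
-- column 1..a_i there is exactly one cell containing i in that column, and these
-- are all a_i cells containing i.  Such a filling is therefore given by the row
-- of the i-cell in each column  c = 1..a_i :  the cell (f i c , col c) holds i.
Filling : {ℓ : ℕ} → Vec ℕ ℓ → Set
Filling {ℓ} a = (i : Fin ℓ) → Fin (lookup a i) → ℕ

-- Kohnert tableau of content a (conditions (i)-(iv)); the cells must be
-- positive and distinct (a diagram is a set of cells, each filled once).
record IsKohnertTableau {ℓ : ℕ} (a : Vec ℕ ℓ) (f : Filling a) : Set where
  field
    rowPos   : ∀ i c → 1 ≤ f i c
    distinct : ∀ i j (c : Fin (lookup a i)) (d : Fin (lookup a j)) →
               col c ≡ col d → f i c ≡ f j d → i ≡ j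
    -- (ii) every entry in row r is at least r
    cond-ii  : ∀ i c → f i c ≤ label i
    cond-iii : ∀ i (c d : Fin (lookup a i)) → col c < col d → f i d ≤ f i c
    -- (iv) i < j in the same column, i above j  ⇒  an i in the next column,
    --      strictly above the j
    cond-iv  : ∀ i j (c : Fin (lookup a i)) (d : Fin (lookup a j)) →
               label i < label j → col c ≡ col d → f j d < f i c →
               ∃[ e ] (col e ≡ suc (col d) × f j d < f i e)

IsQuasiYamanouchi : {ℓ : ℕ} (a : Vec ℕ ℓ) (f : Filling a) → Set
IsQuasiYamanouchi {ℓ} a f =
  ∀ (r : ℕ) → (∃[ i ] ∃[ c ] (f i c ≡ r)) →
    (∃[ i ] ∃[ c ] (f i c ≡ r × label i ≡ r))
    ⊎ (∃[ i ] ∃[ c ] ∃[ j ] ∃[ d ] (f i c ≡ r × f j d ≡ suc r × col c ≤ col d))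

IsQKT : {ℓ : ℕ} (a : Vec ℕ ℓ) (f : Filling a) → Set
IsQKT a f = IsKohnertTableau a f × IsQuasiYamanouchi a f

rowCount : {ℓ : ℕ} (a : Vec ℕ ℓ) → Filling a → ℕ → ℕ
rowCount {ℓ} a f r =
  sum (map (λ i → length (filter (λ c → f i c ≟ r) (allFin (lookup a i)))) (allFin ℓ))

wt : {ℓ : ℕ} (a : Vec ℕ ℓ) → Filling a → Vec ℕ ℓ
wt a f = Data.Vec.tabulate (λ r → rowCount a f (suc (toℕ r)))

SameTableau : {ℓ : ℕ} (a : Vec ℕ ℓ) → Filling a → Filling a → Set
SameTableau a f g = ∀ i c → f i c ≡ g i c

-- κ_a multiplicity free: distinct tableaux in QKT(a) have distinct weights
MultiplicityFree : {ℓ : ℕ} → Vec ℕ ℓ → Set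
MultiplicityFree a = ∀ f g → IsQKT a f → IsQKT a g → wt a f ≡ wt a g → SameTableau a f g

nonzeroParts : {ℓ : ℕ} → Vec ℕ ℓ → ℕ
nonzeroParts a = length (filter (λ x → ¬? (x ≟ 0)) (toList a))

-- Label 1 is forced into row 1 by (ii), so when a has a single further nonzero
-- part a_k a tableau is determined by the rows of its k-cells, read from left to
-- right.  By (iii) these rows weakly descend, and the weight tells how many of
-- them lie in each row; a weakly decreasing sequence is determined by these
-- multiplicities.
module Submission where

open import Defs
open import Data.Nat using (ℕ; zero; suc; _+_; _≤_; _<_; _≥_; _≟_; _<?_; s≤s)
open import Data.Nat.Properties using (≤-antisym; ≤-trans; ≤-<-trans; <⇒≢; ≮⇒≥; 0≢1+n; suc-injective; +-cancelˡ-≡; +-cancelʳ-≡)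
open import Data.Fin using (Fin; zero; suc; toℕ; fromℕ<)
open import Data.Fin.Properties as Fin using (toℕ<n; toℕ-fromℕ<; ¬Fin0)
open import Data.Vec using (Vec; lookup; _∷_)
open import Data.Vec.Properties using (lookup∘tabulate)
open import Data.List using (List; []; _∷_; [_]; length; filter; map; allFin; tabulate)
open import Data.List.Properties using (filter-accept; filter-none; filter-++; length-++; length-map; map-tabulate; tabulate-cong; ∷-injective)
open import Data.List.Relation.Unary.All as All using (All; []; _∷_)
import Data.List.Relation.Unary.All.Properties as All
open import Data.List.Relation.Unary.AllPairs using (AllPairs; []; _∷_)
import Data.List.Relation.Unary.AllPairs.Properties as AllPairs
open import Data.Nat.ListAction using (sum)
open import Data.Bool using (true; false)
open import Data.Product using (_×_; _,_; proj₁; proj₂; ∃-syntax)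
open import Data.Empty using (⊥-elim)
open import Function using (_∘_; id)
open import Relation.Unary using (Decidable)
open import Relation.Nullary using (does; yes; no; contradiction)
open import Relation.Binary.PropositionalEquality using (_≡_; _≢_; refl; sym; trans; cong; subst; module ≡-Reasoning)

open ≡-Reasoning

filter-map : ∀ {A B : Set} {P : B → Set} (P? : Decidable P) (f : A → B) xs →
             filter P? (map f xs) ≡ map f (filter (P? ∘ f) xs)
filter-map P? f [] = refl
filter-map P? f (x ∷ xs) with does (P? (f x))
... | true  = cong (f x ∷_) (filter-map P? f xs)
... | false = filter-map P? f xs

count : ℕ → List ℕ → ℕ
count v xs = length (filter (_≟ v) xs)

count-∷ : ∀ v x xs → count v (x ∷ xs) ≡ count v [ x ] + count v xs
count-∷ v x xs = trans (cong length (filter-++ (_≟ v) [ x ] xs)) (length-++ (filter (_≟ v) [ x ]))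

count-∷-cancel : ∀ v x xs ys → count v (x ∷ xs) ≡ count v (x ∷ ys) → count v xs ≡ count v ys
count-∷-cancel v x xs ys same =
  +-cancelˡ-≡ (count v [ x ]) _ _ (trans (sym (count-∷ v x xs)) (trans same (count-∷ v x ys)))

count-head : ∀ x xs → count x (x ∷ xs) ≡ suc (count x xs)
count-head x xs = cong length (filter-accept (_≟ x) refl)

count-above-all≡0 : ∀ {v xs} → All (_< v) xs → count v xs ≡ 0
count-above-all≡0 xs<v = cong length (filter-none (_≟ _) (All.map <⇒≢ xs<v))

count-tabulate : ∀ {n} (h : Fin n → ℕ) v →
                 length (filter (λ c → h c ≟ v) (allFin n)) ≡ count v (tabulate h)
count-tabulate {n} h v = begin
  length (filter (λ c → h c ≟ v) (allFin n))       ≡⟨ length-map h (filter (λ c → h c ≟ v) (allFin n)) ⟨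
  length (map h (filter (λ c → h c ≟ v) (allFin n))) ≡⟨ cong length (filter-map (_≟ v) h (allFin n)) ⟨
  count v (map h (allFin n))                        ≡⟨ cong (count v) (map-tabulate id h) ⟩
  count v (tabulate h)                              ∎

head-≥ : ∀ {x y xs ys} → All (_≤ x) xs → count y (x ∷ xs) ≡ count y (y ∷ ys) → y ≤ x
head-≥ {x} {y} {xs} {ys} xs≤x same with x <? y
... | no  x≮y = ≮⇒≥ x≮y
... | yes x<y = contradiction (trans (sym absent) (trans same (count-head y ys))) 0≢1+n
  where
  absent : count y (x ∷ xs) ≡ 0
  absent = count-above-all≡0 (x<y ∷ All.map (λ z≤x → ≤-<-trans z≤x x<y) xs≤x)

descending-unique : ∀ {P : ℕ → Set} {xs ys} → AllPairs _≥_ xs → AllPairs _≥_ ys →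
                    All P xs → All P ys → (∀ v → P v → count v xs ≡ count v ys) → xs ≡ ys
descending-unique [] [] _ _ _ = refl
descending-unique {ys = y ∷ ys} [] _ _ (py ∷ _) same =
  contradiction (trans (same y py) (count-head y ys)) 0≢1+n
descending-unique {xs = x ∷ xs} _ [] (px ∷ _) _ same =
  contradiction (trans (sym (same x px)) (count-head x xs)) 0≢1+n
descending-unique {xs = x ∷ xs} {y ∷ ys} (xs≤x ∷ xs↘) (ys≤y ∷ ys↘) (px ∷ pxs) (py ∷ pys) same
  with refl ← ≤-antisym (head-≥ xs≤x (same y py)) (head-≥ ys≤y (sym (same x px))) =
  cong (x ∷_) (descending-unique xs↘ ys↘ pxs pys (λ v pv → count-∷-cancel v x xs ys (same v pv)))

tabulate-injective : ∀ {n} {A : Set} (h h′ : Fin n → A) → tabulate h ≡ tabulate h′ → ∀ c → h c ≡ h′ c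
tabulate-injective h h′ eq zero    = proj₁ (∷-injective eq)
tabulate-injective h h′ eq (suc c) = tabulate-injective (h ∘ suc) (h′ ∘ suc) (proj₂ (∷-injective eq)) c

sum-tabulate-cancel : ∀ {n} (F G : Fin n → ℕ) k → (∀ i → i ≢ k → F i ≡ G i) →
                      sum (tabulate F) ≡ sum (tabulate G) → F k ≡ G k
sum-tabulate-cancel F G zero agree same = +-cancelʳ-≡ (sum (tabulate (G ∘ suc))) (F zero) (G zero) (begin
  F zero + sum (tabulate (G ∘ suc)) ≡⟨ cong (λ t → F zero + sum t) (tabulate-cong (λ i → agree (suc i) λ ())) ⟨
  F zero + sum (tabulate (F ∘ suc)) ≡⟨ same ⟩
  G zero + sum (tabulate (G ∘ suc)) ∎)
sum-tabulate-cancel F G (suc k) agree same =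
  sum-tabulate-cancel (F ∘ suc) (G ∘ suc) k (λ i i≢k → agree (suc i) (i≢k ∘ Fin.suc-injective))
    (+-cancelˡ-≡ (F zero) _ _ (trans same (cong (_+ sum (tabulate (G ∘ suc))) (sym (agree zero λ ())))))

nonzeroParts≡0⇒zero : ∀ {n} (as : Vec ℕ n) → nonzeroParts as ≡ 0 → ∀ j → lookup as j ≡ 0
nonzeroParts≡0⇒zero (zero ∷ as) none zero    = refl
nonzeroParts≡0⇒zero (zero ∷ as) none (suc j) = nonzeroParts≡0⇒zero as none j

nonzeroParts≡1⇒single : ∀ {n} (as : Vec ℕ n) → nonzeroParts as ≡ 1 →
                        ∃[ k ] ∀ j → j ≢ k → lookup as j ≡ 0
nonzeroParts≡1⇒single (suc x ∷ as) one = zero , λ where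
  zero    j≢0 → contradiction refl j≢0
  (suc j) _   → nonzeroParts≡0⇒zero as (suc-injective one) j
nonzeroParts≡1⇒single (zero ∷ as) one with k , others ← nonzeroParts≡1⇒single as one =
  suc k , λ where
    zero    _     → refl
    (suc j) j≢1+k → others j (j≢1+k ∘ cong suc)

module _ {ℓ : ℕ} {a : Vec ℕ ℓ} where

  rowsOfLabel : Filling a → Fin ℓ → List ℕ
  rowsOfLabel f i = tabulate (f i)

  module _ {f : Filling a} (T : IsKohnertTableau a f) where
    open IsKohnertTableau T

    rowsOfLabel-descending : ∀ i → AllPairs _≥_ (rowsOfLabel f i)
    rowsOfLabel-descending i = AllPairs.tabulate⁺-< (λ c<d → cond-iii i _ _ (s≤s c<d))

    rowsOfLabel-in-range : ∀ i → All (λ r → 1 ≤ r × r ≤ ℓ) (rowsOfLabel f i)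
    rowsOfLabel-in-range i = All.tabulate⁺ (λ c → rowPos i c , ≤-trans (cond-ii i c) (toℕ<n i))

  rowCount-as-sum : ∀ f r → rowCount a f r ≡ sum (tabulate (λ i → count r (rowsOfLabel f i)))
  rowCount-as-sum f r = trans (cong sum (map-tabulate id cellsInRow))
                              (cong sum (tabulate-cong (λ i → count-tabulate (f i) r)))
    where
    cellsInRow : Fin ℓ → ℕ
    cellsInRow i = length (filter (λ c → f i c ≟ r) (allFin (lookup a i)))

  wt≡⇒rowCount≡ : ∀ {f g} → wt a f ≡ wt a g → ∀ {r} → 1 ≤ r → r ≤ ℓ → rowCount a f r ≡ rowCount a g r
  wt≡⇒rowCount≡ {f} {g} same {suc r} _ r<ℓ = begin
    rowCount a f (suc r)          ≡⟨ cong (rowCount a f ∘ suc) (toℕ-fromℕ< r<ℓ) ⟨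
    rowCount a f (suc (toℕ i))    ≡⟨ lookup∘tabulate (rowCount a f ∘ suc ∘ toℕ) i ⟨
    lookup (wt a f) i             ≡⟨ cong (λ w → lookup w i) same ⟩
    lookup (wt a g) i             ≡⟨ lookup∘tabulate (rowCount a g ∘ suc ∘ toℕ) i ⟩
    rowCount a g (suc (toℕ i))    ≡⟨ cong (rowCount a g ∘ suc) (toℕ-fromℕ< r<ℓ) ⟩
    rowCount a g (suc r)          ∎
    where
    i : Fin ℓ
    i = fromℕ< r<ℓ

  agree-off-label⇒same : ∀ {f g} → IsKohnertTableau a f → IsKohnertTableau a g → wt a f ≡ wt a g →
                         ∀ k → (∀ i → i ≢ k → ∀ c → f i c ≡ g i c) → SameTableau a f g
  agree-off-label⇒same {f} {g} Tf Tg same k agree i with i Fin.≟ k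
  ... | no i≢k   = agree i i≢k
  ... | yes refl = tabulate-injective (f k) (g k)
    (descending-unique (rowsOfLabel-descending Tf k) (rowsOfLabel-descending Tg k)
                       (rowsOfLabel-in-range Tf k) (rowsOfLabel-in-range Tg k) same-count)
    where
    same-count : ∀ r → 1 ≤ r × r ≤ ℓ → count r (rowsOfLabel f k) ≡ count r (rowsOfLabel g k)
    same-count r (1≤r , r≤ℓ) =
      sum-tabulate-cancel _ _ k (λ i i≢k → cong (count r) (tabulate-cong (agree i i≢k)))
        (trans (sym (rowCount-as-sum f r)) (trans (wt≡⇒rowCount≡ same 1≤r r≤ℓ) (rowCount-as-sum g r)))

label-one-in-row-one : ∀ {m} {a : Vec ℕ (suc m)} {f} → IsKohnertTableau a f → ∀ c → f zero c ≡ 1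
label-one-in-row-one T c = ≤-antisym (cond-ii zero c) (rowPos zero c)
  where open IsKohnertTableau T

theorem5p7 : (m : ℕ) (a : Vec ℕ (suc m)) →
    nonzeroParts a ≡ 2 → lookup a zero ≢ 0 → MultiplicityFree a
theorem5p7 m (zero ∷ as) _ a₁≢0 = contradiction refl a₁≢0
theorem5p7 m (suc x ∷ as) two _ f g (Tf , _) (Tg , _) same
  with k , empty ← nonzeroParts≡1⇒single as (suc-injective two) =
  agree-off-label⇒same Tf Tg same (suc k) agree
  where
  agree : ∀ i → i ≢ suc k → ∀ c → f i c ≡ g i c
  agree zero    _       c = trans (label-one-in-row-one Tf c) (sym (label-one-in-row-one Tg c))
  agree (suc j) j≢1+k   c = ⊥-elim (¬Fin0 (subst Fin (empty j (j≢1+k ∘ cong suc)) c))
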